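{- Let $G$ be a nontrivial cyclic group of order $n$, let $S$ be the set of all generators of $G$, and let $\Gamma(G)$ be the generator graph of $G$. Then $\dim(\Gamma(G)) = n-1$ if $n = |S|+1$, and $\dim(\Gamma(G)) = n-2$ if $n \ge |S|+2$.
   Context: For a group $G$, the generator graph $\Gamma(G)$ is the simple undirected graph whose vertex set is the set of elements of $G$, in which two distinct elements $x,y$ are adjacent if and only if at least one of them generates $G$ (i.e. $\langle x\rangle = G$ or $\langle y\rangle = G$). For a connected graph $\Gamma$ and an ordered set $W=\{w_1,\dots,w_k\}\subseteq V(\Gamma)$, the representation of a vertex $u$ is $r(u\mid W) = (d_\Gamma(u,w_1),\dots,d_\Gamma(u,w_k))$, with $d_\Gamma$ the graph distance; $W$ is a resolving set if $r(u\mid W)\ne r(v\mid W)$ for all distinct $u,v\in V(\Gamma)$. The metric dimension $\dim(\Gamma)$ is the minimum cardinality of a resolving set of $\Gamma$. -}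

module Defs where

open import Level using (Level; _⊔_)
open import Data.Nat using (ℕ; zero; suc; _≤_)
open import Data.Integer using (ℤ; +_; -[1+_])
open import Data.Fin using (Fin)
open import Data.List using (List; length)
open import Data.List.Relation.Unary.All using (All)
open import Data.List.Relation.Unary.AllPairs using (AllPairs)
open import Data.Product using (Σ; ∃; _×_)
open import Data.Sum using (_⊎_)
open import Relation.Nullary using (¬_)
open import Relation.Binary.PropositionalEquality using (_≡_)
open import Function.Bundles using (_⇔_)
open import Algebra.Bundles using (Group)

module GraphDefs {a ℓ r : Level} (V : Set a) (_≈_ : V → V → Set ℓ)
                 (Adj : V → V → Set r) where

  data Walk : V → V → ℕ → Set (a ⊔ ℓ ⊔ r) where
    here : ∀ {u v} → u ≈ v → Walk u v zero
    step : ∀ {u w v k} → Adj u w → Walk w v k → Walk u v (suc k)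

  Dist : V → V → ℕ → Set (a ⊔ ℓ ⊔ r)
  Dist u v m = Walk u v m × (∀ k → Walk u v k → m ≤ k)

  Resolving : List V → Set (a ⊔ ℓ ⊔ r)
  Resolving W = ∀ u v → All (λ w → ∀ m → Dist u w m ⇔ Dist v w m) W → u ≈ v

  -- W has pairwise distinct entries (so length W = |W|)
  Distinct : List V → Set (a ⊔ ℓ)
  Distinct W = AllPairs (λ x y → ¬ (x ≈ y)) W

  MetricDim : ℕ → Set (a ⊔ ℓ ⊔ r)
  MetricDim d =
    (Σ (List V) λ W → Distinct W × Resolving W × length W ≡ d)
    × (∀ W → Distinct W → Resolving W → d ≤ length W)

module GroupDefs {c ℓ : Level} (G : Group c ℓ) where
  open Group G

  powℕ : Carrier → ℕ → Carrier
  powℕ x zero    = ε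
  powℕ x (suc n) = x ∙ powℕ x n

  pow : Carrier → ℤ → Carrier
  pow x (+ n)      = powℕ x n
  pow x -[1+ n ]   = (powℕ x (suc n)) ⁻¹

  Generates : Carrier → Set (c ⊔ ℓ)
  Generates x = ∀ y → ∃ λ (k : ℤ) → pow x k ≈ y

  IsCyclic : Set (c ⊔ ℓ)
  IsCyclic = ∃ Generates

  HasOrder : ℕ → Set (c ⊔ ℓ)
  HasOrder n = Σ (Fin n → Carrier) λ f →
                 (∀ i j → f i ≈ f j → i ≡ j) × (∀ x → ∃ λ i → f i ≈ x)

  NumGenerators : ℕ → Set (c ⊔ ℓ)
  NumGenerators s = Σ (Fin s → Carrier) λ f →
                      (∀ i j → f i ≈ f j → i ≡ j)
                      × (∀ i → Generates (f i))
                      × (∀ x → Generates x → ∃ λ i → f i ≈ x)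

  GenAdj : Carrier → Carrier → Set (c ⊔ ℓ)
  GenAdj x y = ¬ (x ≈ y) × (Generates x ⊎ Generates y)

  GenGraphMetricDim : ℕ → Set (c ⊔ ℓ)
  GenGraphMetricDim = GraphDefs.MetricDim Carrier _≈_ GenAdj

{-# OPTIONS --safe #-}
-- In Γ(G) a generator is adjacent to every other vertex and two non-generators never are, so
-- distinct vertices are at distance 1 unless both are non-generators, which are at distance 2
-- through any generator. Hence two generators, or two non-generators, are twins (equidistant
-- from every third vertex), and a resolving set contains all but at most one vertex of each
-- class; when there is only one non-generator the graph is complete and all but one vertex are
-- needed. Conversely all vertices but one always resolve, and with two non-generators one may
-- also drop a generator g₀ and a non-generator h: a non-generator kept in the set is at
-- distance 1 from g₀ but 2 from h.
module Submission where

open import Defs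
open import Level using (Level)
open import Data.Nat using (ℕ; _+_; _∸_; _≤_)
open import Relation.Binary.PropositionalEquality using (_≡_)
open import Algebra.Bundles using (Group)
open import Data.Product using (_×_)

open import Level using (_⊔_)
open import Data.Nat using (zero; suc; z≤n; s≤s)
open import Data.Integer using (+_; -[1+_])
open import Data.Nat.Properties using (1+n≰n; ≤-trans; ≤-antisym; +-comm; m≤n+o⇒m∸n≤o)
open import Data.Fin using (Fin; zero; suc; join; splitAt; punchIn; punchOut)
open import Data.Fin.Properties
  using (_≟_; any?; injective⇒≤; splitAt-join; suc-injective; punchIn-injective; punchIn-punchOut)
open import Data.List using (List; length; tabulate; lookup)
open import Data.List.Properties using (length-tabulate)
import Data.List.Relation.Unary.All as All
import Data.List.Relation.Unary.All.Properties as Allₚ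
open import Data.List.Relation.Unary.Any as Any using (Any)
import Data.List.Relation.Unary.Any.Properties as Anyₚ
import Data.List.Relation.Unary.AllPairs.Properties as AllPairs
open import Data.Product using (Σ; ∃; ∃₂; _,_; proj₁; proj₂)
open import Data.Sum using (_⊎_; inj₁; inj₂)
import Data.Sum as Sum
open import Data.Sum.Properties using (inj₁-injective; inj₂-injective)
open import Function using (_∘_)
open import Function.Bundles using (_⇔_; mk⇔; Equivalence)
open import Function.Construct.Symmetry using (⇔-sym)
open import Function.Definitions using (Injective)
open import Relation.Binary.Definitions using (Decidable)
open import Relation.Binary.Structures using (IsEquivalence)
open import Relation.Binary.PropositionalEquality
  using (_≢_; refl; sym; trans; cong; subst; module ≡-Reasoning)
open import Relation.Nullary using (¬_; Dec; yes; no; contradiction)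
open import Relation.Nullary.Decidable using (¬?; _×-dec_; map′; decidable-stable)

private variable
  k l m n : ℕ

Hit : (Fin l → Fin n) → Fin n → Set
Hit f i = ∃ λ p → f p ≡ i

Missed : (Fin l → Fin n) → Fin n → Set
Missed f i = ¬ Hit f i

hit? : (f : Fin l → Fin n) → ∀ i → Dec (Hit f i)
hit? f i = any? λ p → f p ≟ i

¬missed⇒hit : (f : Fin l → Fin n) → ∀ {i} → ¬ Missed f i → Hit f i
¬missed⇒hit f {i} = decidable-stable (hit? f i)

⊎-injective⇒≤ : {f : Fin m → Fin k ⊎ Fin l} → Injective _≡_ _≡_ f → m ≤ k + l
⊎-injective⇒≤ {k = k} {l} {f} f-injective = injective⇒≤ λ {i} {j} eq → f-injective (begin
    f i                         ≡⟨ splitAt-join k l (f i) ⟨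
    splitAt k (join k l (f i))  ≡⟨ cong (splitAt k) eq ⟩
    splitAt k (join k l (f j))  ≡⟨ splitAt-join k l (f j) ⟩
    f j                         ∎)
  where open ≡-Reasoning

colouring-missed⇒≤ : (f : Fin l → Fin n) (c : Fin n → Fin k) →
                     (∀ {i j} → Missed f i → Missed f j → c i ≡ c j → i ≡ j) →
                     n ≤ k + l
colouring-missed⇒≤ {l} {n} {k} f c c-injective =
  ⊎-injective⇒≤ {f = λ i → sort (hit? f i)} λ {i} {j} → sort-injective (hit? f i) (hit? f j)
  where
  sort : ∀ {i} → Dec (Hit f i) → Fin k ⊎ Fin l
  sort     (yes (p , _)) = inj₂ p
  sort {i} (no _)        = inj₁ (c i)

  sort-injective : ∀ {i j} (hi : Dec (Hit f i)) (hj : Dec (Hit f j)) →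
                   sort hi ≡ sort hj → i ≡ j
  sort-injective (yes (p , refl)) (yes (q , refl)) eq = cong f (inj₂-injective eq)
  sort-injective (no i-missed)    (no j-missed)    eq =
    c-injective i-missed j-missed (inj₁-injective eq)
  sort-injective (yes _)          (no _)           ()
  sort-injective (no _)           (yes _)          ()

two-missed⇒≤ : {f : Fin l → Fin n} → Injective _≡_ _≡_ f →
               ∀ {i j} → i ≢ j → Missed f i → Missed f j → 2 + l ≤ n
two-missed⇒≤ {l} {n} {f} f-injective {i} {j} i≢j i-missed j-missed = injective⇒≤ g-injective
  where
  g : Fin (2 + l) → Fin n
  g zero          = i
  g (suc zero)    = j
  g (suc (suc p)) = f p

  g-injective : Injective _≡_ _≡_ g
  g-injective {zero}        {zero}        _  = refl
  g-injective {zero}        {suc zero}    eq = contradiction eq i≢j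
  g-injective {zero}        {suc (suc q)} eq = contradiction (q , sym eq) i-missed
  g-injective {suc zero}    {zero}        eq = contradiction (sym eq) i≢j
  g-injective {suc zero}    {suc zero}    _  = refl
  g-injective {suc zero}    {suc (suc q)} eq = contradiction (q , sym eq) j-missed
  g-injective {suc (suc p)} {zero}        eq = contradiction (p , eq) i-missed
  g-injective {suc (suc p)} {suc zero}    eq = contradiction (p , eq) j-missed
  g-injective {suc (suc p)} {suc (suc q)} eq = cong (λ x → suc (suc x)) (f-injective eq)

≤⇒two-missed : (f : Fin l → Fin n) → 2 + l ≤ n → ∃₂ λ i j → i ≢ j × Missed f i × Missed f j
≤⇒two-missed {l} {n} f 2+l≤n
  with any? (λ i → any? λ j → ¬? (i ≟ j) ×-dec ¬? (hit? f i) ×-dec ¬? (hit? f j))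
... | yes (i , j , two-missed) = i , j , two-missed
... | no none =
  contradiction (≤-trans 2+l≤n (colouring-missed⇒≤ f (λ _ → zero) at-most-one)) 1+n≰n
  where
  at-most-one : ∀ {i j} → Missed f i → Missed f j → zero ≡ zero → i ≡ j
  at-most-one {i} {j} i-missed j-missed _ =
    decidable-stable (i ≟ j) λ i≢j → none (i , j , i≢j , i-missed , j-missed)

missed-by-suc : {i : Fin (suc n)} → Missed suc i → i ≡ zero
missed-by-suc {i = zero}  _        = refl
missed-by-suc {i = suc p} p-missed = contradiction (p , refl) p-missed

missed-by-punchIn₂ : {i : Fin (2 + n)} {j : Fin (suc n)} {x : Fin (2 + n)} →
                     Missed (punchIn i ∘ punchIn j) x → x ≡ i ⊎ x ≡ punchIn i j
missed-by-punchIn₂ {i = i} {j} {x} x-missed with i ≟ x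
... | yes i≡x = inj₁ (sym i≡x)
... | no i≢x with j ≟ punchOut i≢x
...   | yes j≡x′ = inj₂ (trans (sym (punchIn-punchOut i≢x)) (cong (punchIn i) (sym j≡x′)))
...   | no j≢x′ = contradiction
          (punchOut j≢x′ , trans (cong (punchIn i) (punchIn-punchOut j≢x′)) (punchIn-punchOut i≢x))
          x-missed

complement-of-two : {i j : Fin (2 + n)} → i ≢ j →
                    Σ (Fin n → Fin (2 + n)) λ f →
                      Injective _≡_ _≡_ f × (∀ {x} → Missed f x → x ≡ i ⊎ x ≡ j)
complement-of-two {i = i} i≢j =
    punchIn i ∘ punchIn (punchOut i≢j)
  , punchIn-injective _ _ _ ∘ punchIn-injective _ _ _
  , Sum.map₂ (λ x≡ → trans x≡ (punchIn-punchOut i≢j)) ∘ missed-by-punchIn₂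

module GraphMetric {a ℓ r} {V : Set a} {_≈_ : V → V → Set ℓ}
                   (≈-isEquivalence : IsEquivalence _≈_) (Adj : V → V → Set r) where
  open GraphDefs V _≈_ Adj public
  open IsEquivalence ≈-isEquivalence
    renaming (refl to ≈-refl; sym to ≈-sym; trans to ≈-trans; reflexive to ≈-reflexive)

  Walk-zero⇒≈ : ∀ {u w} → Walk u w 0 → u ≈ w
  Walk-zero⇒≈ (here u≈w) = u≈w

  Dist-zero : ∀ {u w} → u ≈ w → Dist u w 0
  Dist-zero u≈w = here u≈w , λ _ _ → z≤n

  Dist-one : ∀ {u w} → Adj u w → ¬ u ≈ w → Dist u w 1
  Dist-one adj u≉w = step adj (here ≈-refl) , minimal
    where
    minimal : ∀ d → Walk _ _ d → 1 ≤ d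
    minimal zero    (here u≈w) = contradiction u≈w u≉w
    minimal (suc _) _          = s≤s z≤n

  Dist-unique : ∀ {u w d d′} → Dist u w d → Dist u w d′ → d ≡ d′
  Dist-unique (walk , minimal) (walk′ , minimal′) = ≤-antisym (minimal _ walk′) (minimal′ _ walk)

  ResolvingSetOfSize : ℕ → Set (a ⊔ ℓ ⊔ r)
  ResolvingSetOfSize d = Σ (List V) λ W → Distinct W × Resolving W × length W ≡ d

  SameDistances : V → V → List V → Set (a ⊔ ℓ ⊔ r)
  SameDistances u v = All.All λ w → ∀ d → Dist u w d ⇔ Dist v w d

  SameDistances-sym : ∀ {u v W} → SameDistances u v W → SameDistances v u W
  SameDistances-sym = All.map (⇔-sym ∘_)

  SameDistances-member⇒≈ : ∀ {u v W} → SameDistances u v W → Any (u ≈_) W → u ≈ v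
  SameDistances-member⇒≈ same u∈W with All.lookupAny same u∈W
  ... | same-at-w , u≈w =
    ≈-trans u≈w (≈-sym (Walk-zero⇒≈ (proj₁ (Equivalence.to (same-at-w 0) (Dist-zero u≈w)))))

  Twins : V → V → Set (a ⊔ ℓ ⊔ r)
  Twins u v = ∀ w → ¬ u ≈ w → ¬ v ≈ w → ∃ λ d → Dist u w d × Dist v w d

  resolving-separates-twins : ∀ {u v W} → Resolving W → Twins u v →
                              ¬ Any (u ≈_) W → ¬ Any (v ≈_) W → u ≈ v
  resolving-separates-twins {u} {v} res twins u∉W v∉W =
    res u v (All.tabulate λ w∈W → agree (twins _ (u∉W ∘ near w∈W) (v∉W ∘ near w∈W)))
    where
    near : ∀ {x w W} → Any (w ≡_) W → x ≈ w → Any (x ≈_) W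
    near w∈W x≈w = Any.map (λ w≡y → subst (_ ≈_) w≡y x≈w) w∈W

    agree : ∀ {w} → (∃ λ d → Dist u w d × Dist v w d) → ∀ d → Dist u w d ⇔ Dist v w d
    agree {w} (_ , du , dv) d = mk⇔
      (λ du′ → subst (Dist v w) (Dist-unique du du′) dv)
      (λ dv′ → subst (Dist u w) (Dist-unique dv dv′) du)

  module Enumerated {n} (e : Fin n → V) (e-injective : ∀ i j → e i ≈ e j → i ≡ j)
                    (e-surjective : ∀ x → ∃ λ i → e i ≈ x) where

    index : V → Fin n
    index x = proj₁ (e-surjective x)

    e-index : ∀ x → e (index x) ≈ x
    e-index x = proj₂ (e-surjective x)

    index≡⇒≈ : ∀ {i x} → index x ≡ i → e i ≈ x
    index≡⇒≈ {x = x} eq = ≈-trans (≈-reflexive (cong e (sym eq))) (e-index x)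

    index-injective : ∀ {x y} → index x ≡ index y → x ≈ y
    index-injective {x} eq = ≈-trans (≈-sym (e-index x)) (index≡⇒≈ (sym eq))

    index-cong : ∀ {x y} → x ≈ y → index x ≡ index y
    index-cong {x} {y} x≈y =
      e-injective _ _ (≈-trans (e-index x) (≈-trans x≈y (≈-sym (e-index y))))

    index-e : ∀ i → index (e i) ≡ i
    index-e i = e-injective _ _ (e-index (e i))

    _≈?_ : Decidable _≈_
    x ≈? y = map′ index-injective index-cong (index x ≟ index y)

    n≤k+length-resolving : ∀ {k W} → Resolving W → (c : Fin n → Fin k) →
                           (∀ {i j} → c i ≡ c j → Twins (e i) (e j)) → n ≤ k + length W
    n≤k+length-resolving {W = W} res c twins = colouring-missed⇒≤ (index ∘ lookup W) c
      λ i-missed j-missed same-colour → e-injective _ _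
        (resolving-separates-twins res (twins same-colour) (outside i-missed) (outside j-missed))
      where
      outside : ∀ {i} → Missed (index ∘ lookup W) i → ¬ Any (e i ≈_) W
      outside {i} i-missed i∈W = i-missed
        (Any.index i∈W , trans (index-cong (≈-sym (Anyₚ.lookup-index i∈W))) (index-e i))

    module _ {l} (f : Fin l → Fin n) where

      image : List V
      image = tabulate (e ∘ f)

      length-image : length image ≡ l
      length-image = length-tabulate (e ∘ f)

      image-distinct : Injective _≡_ _≡_ f → Distinct image
      image-distinct f-injective = AllPairs.tabulate⁺ λ i≢j → i≢j ∘ f-injective ∘ e-injective _ _

      ∈-image : ∀ {x} → Hit f (index x) → Any (x ≈_) image
      ∈-image (p , fp≡ix) = Anyₚ.tabulate⁺ p (≈-sym (index≡⇒≈ (sym fp≡ix)))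

      image-resolving : (∀ {u v} → Missed f (index u) → Missed f (index v) →
                                   SameDistances u v image → u ≈ v) →
                        Resolving image
      image-resolving resolve-missed u v same
        with hit? f (index u) | hit? f (index v)
      ... | yes u-hit   | _           = SameDistances-member⇒≈ same (∈-image u-hit)
      ... | no _        | yes v-hit   =
        ≈-sym (SameDistances-member⇒≈ (SameDistances-sym same) (∈-image v-hit))
      ... | no u-missed | no v-missed = resolve-missed u-missed v-missed same

      image-resolving-if-one-missed : (∀ {i j} → Missed f i → Missed f j → i ≡ j) → Resolving image
      image-resolving-if-one-missed one-missed =
        image-resolving λ u-missed v-missed _ → index-injective (one-missed u-missed v-missed)

module GeneratorGraph {c ℓ} (G : Group c ℓ) where
  open Group G using (Carrier; _≈_; ∙-cong; ⁻¹-cong; isEquivalence)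
  open IsEquivalence isEquivalence
    renaming (refl to ≈-refl; sym to ≈-sym; trans to ≈-trans; reflexive to ≈-reflexive)
  open GroupDefs G
  open GraphMetric isEquivalence GenAdj public

  powℕ-cong : ∀ {x y} k → x ≈ y → powℕ x k ≈ powℕ y k
  powℕ-cong zero    x≈y = ≈-refl
  powℕ-cong (suc k) x≈y = ∙-cong x≈y (powℕ-cong k x≈y)

  pow-cong : ∀ {x y} k → x ≈ y → pow x k ≈ pow y k
  pow-cong (+ k)    x≈y = powℕ-cong k x≈y
  pow-cong -[1+ k ] x≈y = ⁻¹-cong (powℕ-cong (suc k) x≈y)

  Generates-resp : ∀ {x y} → Generates x → x ≈ y → Generates y
  Generates-resp gen-x x≈y z with gen-x z
  ... | k , xᵏ≈z = k , ≈-trans (≈-sym (pow-cong k x≈y)) xᵏ≈z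

  Dist-generator : ∀ {u w} → ¬ u ≈ w → Generates u ⊎ Generates w → Dist u w 1
  Dist-generator u≉w gen = Dist-one (u≉w , gen) u≉w

  Dist-non-generators : ∀ {g u w} → Generates g → ¬ u ≈ w →
                        ¬ Generates u → ¬ Generates w → Dist u w 2
  Dist-non-generators {g} {u} {w} gen-g u≉w ngen-u ngen-w =
    step (u≉g , inj₂ gen-g) (step (g≉w , inj₁ gen-g) (here ≈-refl)) , minimal
    where
    u≉g : ¬ u ≈ g
    u≉g u≈g = ngen-u (Generates-resp gen-g (≈-sym u≈g))

    g≉w : ¬ g ≈ w
    g≉w g≈w = ngen-w (Generates-resp gen-g g≈w)

    minimal : ∀ d → Walk u w d → 2 ≤ d
    minimal zero          (here u≈w)                        = contradiction u≈w u≉w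
    minimal (suc zero)    (step (_ , inj₁ gen-u) (here _))   = contradiction gen-u ngen-u
    minimal (suc zero)    (step (_ , inj₂ gen-x) (here x≈w)) =
      contradiction (Generates-resp gen-x x≈w) ngen-w
    minimal (suc (suc _)) _                                 = s≤s (s≤s z≤n)

  generators-twins : ∀ {u v} → Generates u → Generates v → Twins u v
  generators-twins gen-u gen-v _ u≉w v≉w =
    1 , Dist-generator u≉w (inj₁ gen-u) , Dist-generator v≉w (inj₁ gen-v)

  non-generator-separates : ∀ {g u v w} → Generates g → Generates u → ¬ Generates v →
                            ¬ Generates w → ¬ v ≈ w → ¬ (∀ d → Dist u w d ⇔ Dist v w d)
  non-generator-separates gen-g gen-u ngen-v ngen-w v≉w same = contradiction
    (Dist-unique (Equivalence.to (same 1) (Dist-generator u≉w (inj₁ gen-u)))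
                 (Dist-non-generators gen-g v≉w ngen-v ngen-w))
    λ ()
    where
    u≉w : ¬ _ ≈ _
    u≉w u≈w = ngen-w (Generates-resp gen-u u≈w)

  module Finite {m s} (e : Fin (2 + m) → Carrier) (e-injective : ∀ i j → e i ≈ e j → i ≡ j)
                (e-surjective : ∀ x → ∃ λ i → e i ≈ x)
                (gens : Fin s → Carrier) (gens-injective : ∀ i j → gens i ≈ gens j → i ≡ j)
                (gens-generate : ∀ i → Generates (gens i))
                (gens-surjective : ∀ x → Generates x → ∃ λ i → gens i ≈ x)
                (g₀ : Carrier) (gen-g₀ : Generates g₀) where
    open Enumerated e e-injective e-surjective public

    generates? : ∀ x → Dec (Generates x)
    generates? x = map′ (λ (k , gₖ≈x) → Generates-resp (gens-generate k) gₖ≈x) (gens-surjective x)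
                        (any? λ k → gens k ≈? x)

    non-generators-twins : ∀ {u v} → ¬ Generates u → ¬ Generates v → Twins u v
    non-generators-twins ngen-u ngen-v w u≉w v≉w with generates? w
    ... | yes gen-w = 1 , Dist-generator u≉w (inj₂ gen-w) , Dist-generator v≉w (inj₂ gen-w)
    ... | no ngen-w = 2 , Dist-non-generators gen-g₀ u≉w ngen-u ngen-w
                        , Dist-non-generators gen-g₀ v≉w ngen-v ngen-w

    generator-colour : Carrier → Fin 2
    generator-colour x with generates? x
    ... | yes _ = zero
    ... | no _  = suc zero

    same-colour-twins : ∀ {u v} → generator-colour u ≡ generator-colour v → Twins u v
    same-colour-twins {u} {v} with generates? u | generates? v
    ... | yes gen-u | yes gen-v = λ _ → generators-twins gen-u gen-v
    ... | no ngen-u | no ngen-v = λ _ → non-generators-twins ngen-u ngen-v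
    ... | yes _     | no _      = λ ()
    ... | no _      | yes _     = λ ()

    generator-index : Fin s → Fin (2 + m)
    generator-index = index ∘ gens

    non-generator⇒missed : ∀ {x} → ¬ Generates x → Missed generator-index (index x)
    non-generator⇒missed ngen-x (k , eq) =
      ngen-x (Generates-resp (gens-generate k) (index-injective eq))

    missed⇒non-generator : ∀ {i} → Missed generator-index i → ¬ Generates (e i)
    missed⇒non-generator {i} i-missed gen with gens-surjective (e i) gen
    ... | k , gₖ≈eᵢ = i-missed (k , trans (index-cong gₖ≈eᵢ) (index-e i))

    unique-non-generator : 2 + m ≡ s + 1 → ∀ {x y} → ¬ Generates x → ¬ Generates y → x ≈ y
    unique-non-generator n≡s+1 {x} {y} ngen-x ngen-y =
      index-injective (decidable-stable (index x ≟ index y) λ ix≢iy → 1+n≰n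
        (subst (2 + s ≤_) (trans n≡s+1 (+-comm s 1))
          (two-missed⇒≤ (λ eq → gens-injective _ _ (index-injective eq)) ix≢iy
            (non-generator⇒missed ngen-x) (non-generator⇒missed ngen-y))))

    adjacent-if-unique-non-generator : 2 + m ≡ s + 1 → ∀ {u w} → ¬ u ≈ w → Dist u w 1
    adjacent-if-unique-non-generator n≡s+1 {u} {w} u≉w with generates? u | generates? w
    ... | yes gen-u | _         = Dist-generator u≉w (inj₁ gen-u)
    ... | no _      | yes gen-w = Dist-generator u≉w (inj₂ gen-w)
    ... | no ngen-u | no ngen-w = contradiction (unique-non-generator n≡s+1 ngen-u ngen-w) u≉w

    n≤1+length-resolving : 2 + m ≡ s + 1 → ∀ {W} → Resolving W → 2 + m ≤ 1 + length W
    n≤1+length-resolving n≡s+1 res = n≤k+length-resolving res (λ _ → zero)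
      λ _ _ u≉w v≉w → 1 , adjacent u≉w , adjacent v≉w
      where
      adjacent : ∀ {u w} → ¬ u ≈ w → Dist u w 1
      adjacent = adjacent-if-unique-non-generator n≡s+1

    n≤2+length-resolving : ∀ {W} → Resolving W → 2 + m ≤ 2 + length W
    n≤2+length-resolving res = n≤k+length-resolving res (generator-colour ∘ e) same-colour-twins

    resolving-set-of-size-n∸1 : ResolvingSetOfSize (1 + m)
    resolving-set-of-size-n∸1 =
      image suc , image-distinct suc suc-injective ,
      image-resolving-if-one-missed suc
        (λ i-missed j-missed → trans (missed-by-suc i-missed) (sym (missed-by-suc j-missed))) ,
      length-image suc

    generates-at-g₀ : Generates (e (index g₀))
    generates-at-g₀ = Generates-resp gen-g₀ (≈-sym (e-index g₀))

    generator≢non-generator : ∀ {i j} → Generates (e i) → ¬ Generates (e j) → i ≢ j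
    generator≢non-generator gen-i ngen-j refl = ngen-j gen-i

    image-resolving-if-misses-generator-and-non-generator :
      ∀ {l i₀ j₀ j₁} (f : Fin l → Fin (2 + m)) → (∀ {x} → Missed f x → x ≡ i₀ ⊎ x ≡ j₀) →
      Generates (e i₀) → ¬ Generates (e j₀) → ¬ Generates (e j₁) → j₀ ≢ j₁ → Resolving (image f)
    image-resolving-if-misses-generator-and-non-generator {i₀ = i₀} {j₀} {j₁}
      f misses gen-i₀ ngen-j₀ ngen-j₁ j₀≢j₁ = image-resolving f resolve-missed
      where
      j₁-hit : Hit f j₁
      j₁-hit = ¬missed⇒hit f
        (Sum.[ generator≢non-generator gen-i₀ ngen-j₁ ∘ sym , j₀≢j₁ ∘ sym ] ∘ misses)

      h : Carrier
      h = e (f (proj₁ j₁-hit))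

      separated : ∀ {u v} → index u ≡ i₀ → index v ≡ j₀ → ¬ (∀ d → Dist u h d ⇔ Dist v h d)
      separated {v = v} u-at-i₀ v-at-j₀ = non-generator-separates gen-g₀
        (Generates-resp gen-i₀ (index≡⇒≈ u-at-i₀))
        (λ gen-v → ngen-j₀ (Generates-resp gen-v (≈-sym (index≡⇒≈ v-at-j₀))))
        (subst (λ j → ¬ Generates (e j)) (sym (proj₂ j₁-hit)) ngen-j₁)
        (λ v≈h → j₀≢j₁ (begin
          j₀                ≡⟨ v-at-j₀ ⟨
          index v           ≡⟨ index-cong v≈h ⟩
          index h           ≡⟨ index-e _ ⟩
          f (proj₁ j₁-hit)  ≡⟨ proj₂ j₁-hit ⟩
          j₁                ∎))
        where open ≡-Reasoning

      resolve-missed : ∀ {u v} → Missed f (index u) → Missed f (index v) →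
                       SameDistances u v (image f) → u ≈ v
      resolve-missed u-missed v-missed same with misses u-missed | misses v-missed
      ... | inj₁ u-at-i₀ | inj₁ v-at-i₀ = index-injective (trans u-at-i₀ (sym v-at-i₀))
      ... | inj₂ u-at-j₀ | inj₂ v-at-j₀ = index-injective (trans u-at-j₀ (sym v-at-j₀))
      ... | inj₁ u-at-i₀ | inj₂ v-at-j₀ =
        contradiction (Allₚ.tabulate⁻ same (proj₁ j₁-hit)) (separated u-at-i₀ v-at-j₀)
      ... | inj₂ u-at-j₀ | inj₁ v-at-i₀ =
        contradiction (Allₚ.tabulate⁻ (SameDistances-sym same) (proj₁ j₁-hit))
                      (separated v-at-i₀ u-at-j₀)

    resolving-set-of-size-n∸2 : s + 2 ≤ 2 + m → ResolvingSetOfSize m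
    resolving-set-of-size-n∸2 s+2≤n
      with ≤⇒two-missed generator-index (subst (_≤ 2 + m) (+-comm s 2) s+2≤n)
    ... | j₀ , j₁ , j₀≢j₁ , j₀-missed , j₁-missed
      with complement-of-two
             (generator≢non-generator generates-at-g₀ (missed⇒non-generator j₀-missed))
    ...   | f , f-injective , misses =
      image f , image-distinct f f-injective ,
      image-resolving-if-misses-generator-and-non-generator f misses generates-at-g₀
        (missed⇒non-generator j₀-missed) (missed⇒non-generator j₁-missed) j₀≢j₁ ,
      length-image f

theorem5p2 : ∀ {c ℓ : Level} (G : Group c ℓ) (n s : ℕ) →
    GroupDefs.IsCyclic G → GroupDefs.HasOrder G n → 2 ≤ n →
    GroupDefs.NumGenerators G s →
    ((n ≡ s + 1 → GroupDefs.GenGraphMetricDim G (n ∸ 1))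
     × (s + 2 ≤ n → GroupDefs.GenGraphMetricDim G (n ∸ 2)))
theorem5p2 G zero          s _ _ () _
theorem5p2 G (suc zero)    s _ _ (s≤s ()) _
theorem5p2 G (suc (suc m)) s (g₀ , gen-g₀) (e , e-injective , e-surjective) _
           (gens , gens-injective , gens-generate , gens-surjective) =
    (λ n≡s+1 → resolving-set-of-size-n∸1
             , λ _ _ res → m≤n+o⇒m∸n≤o _ 1 (n≤1+length-resolving n≡s+1 res))
  , (λ s+2≤n → resolving-set-of-size-n∸2 s+2≤n
             , λ _ _ res → m≤n+o⇒m∸n≤o _ 2 (n≤2+length-resolving res))
  where
  open GeneratorGraph.Finite G e e-injective e-surjective
         gens gens-injective gens-generate gens-surjective g₀ gen-g₀
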